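{- Let $r\ge 2$ be an integer and let $\mathcal{H}$ be a connected $r$-uniform hypergraph on $n$ vertices with $e(\mathcal{H})\ge n$. Then for every vertex $v\in V(\mathcal{H})$, either there exists a Berge path of length $r+1$ starting from $v$, or there exists a Berge cycle of length $r+1$ having $v$ as one of its vertices.
   Context: A hypergraph $\mathcal{H}$ consists of a finite vertex set $V(\mathcal{H})$ and a set $E(\mathcal{H})$ of distinct subsets of $V(\mathcal{H})$ (hyperedges; no repeated hyperedges); $n=|V(\mathcal{H})|$ and $e(\mathcal{H})=|E(\mathcal{H})|$. It is $r$-uniform if every hyperedge has exactly $r$ vertices. It is connected if for any two vertices $x,y$ there is a sequence of vertices $x=x_0,x_1,\dots,x_m=y$ such that each consecutive pair $x_{j-1},x_j$ lies in a common hyperedge. A Berge path of length $k$ is a collection of $k$ distinct hyperedges $e_1,\dots,e_k$ and $k+1$ distinct vertices $v_1,\dots,v_{k+1}$ such that $v_i,v_{i+1}\in e_i$ for each $1\le i\le k$; it starts at $v_1$. A Berge cycle of length $k$ is a collection of $k$ distinct hyperedges $e_1,\dots,e_k$ and $k$ distinct vertices $v_1,\dots,v_k$ such that $v_i,v_{i+1}\in e_i$ for $1\le i\le k-1$ and $v_k,v_1\in e_k$; the $v_i$ are its vertices. -}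

module Defs where

open import Data.Nat using (ℕ; zero; suc)
open import Data.Fin using (Fin; zero; suc; inject₁; fromℕ)
open import Data.Fin.Subset using (Subset; _∈_; ∣_∣)
open import Data.Product using (Σ; ∃; _×_)
open import Function.Definitions using (Injective)
open import Relation.Binary.PropositionalEquality using (_≡_)

record Hypergraph (n : ℕ) : Set where
  field
    m        : ℕ
    edge     : Fin m → Subset n
    distinct : Injective _≡_ _≡_ edge
open Hypergraph public

e : ∀ {n} → Hypergraph n → ℕ
e H = m H

Uniform : ∀ {n} → ℕ → Hypergraph n → Set
Uniform r H = ∀ (i : Fin (m H)) → ∣ edge H i ∣ ≡ r

Adjacent : ∀ {n} → Hypergraph n → Fin n → Fin n → Set
Adjacent H x y = Σ (Fin (m H)) λ i → (x ∈ edge H i) × (y ∈ edge H i)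

Connected : ∀ {n} → Hypergraph n → Set
Connected {n} H = ∀ (x y : Fin n) →
  Σ ℕ λ len → Σ (Fin (suc len) → Fin n) λ p →
    (p zero ≡ x) × (p (fromℕ len) ≡ y) ×
    (∀ (j : Fin len) → Adjacent H (p (inject₁ j)) (p (suc j)))

BergePathFrom : ∀ {n} → Hypergraph n → ℕ → Fin n → Set
BergePathFrom {n} H k v =
  Σ (Fin k → Fin (m H)) λ es → Σ (Fin (suc k) → Fin n) λ vs →
    Injective _≡_ _≡_ es × Injective _≡_ _≡_ vs ×
    (∀ (i : Fin k) → (vs (inject₁ i) ∈ edge H (es i)) × (vs (suc i) ∈ edge H (es i))) ×
    (vs zero ≡ v)

-- Berge cycle of length suc k containing vertex v: suc k distinct hyperedges
-- es 0 … es k and suc k distinct vertices vs 0 … vs k with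
-- vs i, vs (i+1) ∈ es i for i < k, and vs k, vs 0 ∈ es k; v is some vs j.
BergeCycleThrough : ∀ {n} → Hypergraph n → ℕ → Fin n → Set
BergeCycleThrough {n} H k v =
  Σ (Fin (suc k) → Fin (m H)) λ es → Σ (Fin (suc k) → Fin n) λ vs →
    Injective _≡_ _≡_ es × Injective _≡_ _≡_ vs ×
    (∀ (i : Fin k) → (vs (inject₁ i) ∈ edge H (es (inject₁ i))) × (vs (suc i) ∈ edge H (es (inject₁ i)))) ×
    (vs (fromℕ k) ∈ edge H (es (fromℕ k))) × (vs zero ∈ edge H (es (fromℕ k))) ×
    (∃ λ j → vs j ≡ v)

-- A depth-first search of the incidence graph of H from v, cut off at depth r, keeps a Berge path from v
-- as its stack. At depth r every edge at the tip already lies on the path: otherwise it extends the path,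
-- closes a cycle through v, or replaces the last edge of the path, and then the replaced edge does one of
-- these. An edge bringing no new vertex lies on the stack, so it hangs one level above the cut-off and
-- consists of exactly the stack. Among the children of an edge g at most one carries such a leaf, and then
-- g has another child: otherwise the leaves, g and the paths through g close a Berge cycle of length r + 1
-- through v. Counting, the search sees fewer edges than vertices; by connectivity it sees all of H,
-- contradicting n ≤ e(H).

module Submission where

open import Data.Fin using (Fin; zero; suc; inject₁; fromℕ; opposite; _≟_)
open import Data.Fin.Properties using (any?; opposite-involutive)
open import Data.Fin.Subset using (Subset; inside; outside; _∈_; _∉_; _⊆_; ⊥; ⊤; ⁅_⁆; _∪_; _-_; ∣_∣)
open import Data.Fin.Subset.Properties
  using ( _∈?_; ∉⊥; x∈⁅x⁆; x∈⁅y⁆⇒x≡y; x∈p∪q⁺; x∈p∪q⁻; q⊆p∪q; ∪-identityˡ; ⊆-antisym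
        ; x∈p∧x≢y⇒x∈p-y; p⊆q⇒∣p∣≤∣q∣; p⊂q⇒∣p∣<∣q∣; x∈p⇒∣p-x∣<∣p∣; ∣⊥∣≡0; ∣⊤∣≡n; ∣⁅x⁆∣≡1; ∣p∣≤n )
open import Data.Nat using (ℕ; zero; suc; _≤_; _+_; z≤n; s≤s)
open import Data.Nat.Properties
  using ( module ≤-Reasoning; suc-injective; n≤0⇒n≡0; <⇒≱; ≤⇒≯; ≤-pred; ≤-trans; ≤-refl; ≤-reflexive
        ; m≤n⇒m≤1+n; +-comm; +-identityʳ; +-suc; +-mono-≤; +-monoˡ-≤; +-monoʳ-≤; +-cancelˡ-≤; +-cancelʳ-≤ )
open import Data.Nat.Tactic.RingSolver using (solve-∀)
open import Data.Product using (∃; _×_; _,_; proj₁; proj₂)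
open import Data.Sum as Sum using (_⊎_; inj₁; inj₂; [_,_]′; fromInj₁)
open import Data.Vec as Vec using (Vec; []; _∷_; lookup; _∷ʳ_; allFin)
open import Data.Vec.Membership.Propositional using () renaming (_∈_ to _∈ᵥ_; _∉_ to _∉ᵥ_)
open import Data.Vec.Membership.Propositional.Properties using (∈-allFin⁺)
open import Data.Vec.Relation.Unary.All as All using (All; []; _∷_)
open import Data.Vec.Relation.Unary.Any using (here; there)
open import Data.Vec.Relation.Unary.Unique.Propositional using (Unique; []; _∷_)
open import Data.Vec.Relation.Unary.Unique.Propositional.Properties using (lookup-injective)
open import Function using (_∘_; case_of_)
open import Function.Definitions using (Injective)
open import Level using (0ℓ)
open import Relation.Binary.PropositionalEquality
  using (_≡_; _≢_; refl; sym; trans; cong; cong₂; subst; subst₂; module ≡-Reasoning)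
open import Relation.Nullary using (¬_; yes; no; contradiction)
open import Relation.Nullary.Decidable using (_×-dec_; ¬?; decidable-stable)
open import Relation.Unary using (Pred; Decidable)

open import Defs

private variable
  k n : ℕ

-- Finite sets, vectors and counting

x∈⁅x⁆∪p : ∀ {x : Fin n} {p} → x ∈ ⁅ x ⁆ ∪ p
x∈⁅x⁆∪p {x = x} = x∈p∪q⁺ (inj₁ (x∈⁅x⁆ x))

x∈⁅y⁆∪p⁻ : ∀ {x y : Fin n} {p} → x ∈ ⁅ y ⁆ ∪ p → x ≡ y ⊎ x ∈ p
x∈⁅y⁆∪p⁻ {y = y} {p} x∈ with x∈p∪q⁻ ⁅ y ⁆ p x∈
... | inj₁ x∈⁅y⁆ = inj₁ (x∈⁅y⁆⇒x≡y y x∈⁅y⁆)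
... | inj₂ x∈p  = inj₂ x∈p

∣⁅x⁆∪p∣≡1+∣p∣ : ∀ {x : Fin n} {p} → x ∉ p → ∣ ⁅ x ⁆ ∪ p ∣ ≡ suc ∣ p ∣
∣⁅x⁆∪p∣≡1+∣p∣ {x = zero}  {inside ∷ p}  x∉p = contradiction Vec.here x∉p
∣⁅x⁆∪p∣≡1+∣p∣ {x = zero}  {outside ∷ p} x∉p = cong (suc ∘ ∣_∣) (∪-identityˡ p)
∣⁅x⁆∪p∣≡1+∣p∣ {x = suc x} {inside ∷ p}  x∉p = cong suc (∣⁅x⁆∪p∣≡1+∣p∣ (x∉p ∘ Vec.there))
∣⁅x⁆∪p∣≡1+∣p∣ {x = suc x} {outside ∷ p} x∉p = ∣⁅x⁆∪p∣≡1+∣p∣ (x∉p ∘ Vec.there)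

∣⁅x⁆∪p∣≤1+∣p∣ : ∀ (x : Fin n) p → ∣ ⁅ x ⁆ ∪ p ∣ ≤ suc ∣ p ∣
∣⁅x⁆∪p∣≤1+∣p∣ zero    (inside ∷ p)  = s≤s (m≤n⇒m≤1+n (≤-reflexive (cong ∣_∣ (∪-identityˡ p))))
∣⁅x⁆∪p∣≤1+∣p∣ zero    (outside ∷ p) = s≤s (≤-reflexive (cong ∣_∣ (∪-identityˡ p)))
∣⁅x⁆∪p∣≤1+∣p∣ (suc x) (inside ∷ p)  = s≤s (∣⁅x⁆∪p∣≤1+∣p∣ x p)
∣⁅x⁆∪p∣≤1+∣p∣ (suc x) (outside ∷ p) = ∣⁅x⁆∪p∣≤1+∣p∣ x p

p⊆q∧∣q∣≤∣p∣⇒q⊆p : ∀ {p q : Subset n} → p ⊆ q → ∣ q ∣ ≤ ∣ p ∣ → q ⊆ p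
p⊆q∧∣q∣≤∣p∣⇒q⊆p {p = p} p⊆q ∣q∣≤∣p∣ {x} x∈q with x ∈? p
... | yes x∈p = x∈p
... | no  x∉p = contradiction (p⊂q⇒∣p∣<∣q∣ (p⊆q , x , x∈q , x∉p)) (≤⇒≯ ∣q∣≤∣p∣)

toSubset : Vec (Fin n) k → Subset n
toSubset []       = ⊥
toSubset (x ∷ xs) = ⁅ x ⁆ ∪ toSubset xs

∈-toSubset⁺ : ∀ {x : Fin n} {xs : Vec (Fin n) k} → x ∈ᵥ xs → x ∈ toSubset xs
∈-toSubset⁺ (here refl) = x∈⁅x⁆∪p
∈-toSubset⁺ {xs = y ∷ _} (there x∈) = q⊆p∪q ⁅ y ⁆ _ (∈-toSubset⁺ x∈)

∣toSubset∣≤length : ∀ {n k} (xs : Vec (Fin n) k) → ∣ toSubset xs ∣ ≤ k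
∣toSubset∣≤length {n} []       = ≤-reflexive (∣⊥∣≡0 n)
∣toSubset∣≤length (x ∷ xs) = ≤-trans (∣⁅x⁆∪p∣≤1+∣p∣ x (toSubset xs)) (s≤s (∣toSubset∣≤length xs))

module _ {A : Set} {x : A} where

  ∉⇒All≢ : ∀ {xs : Vec A k} → x ∉ᵥ xs → All (x ≢_) xs
  ∉⇒All≢ {xs = []}    _  = []
  ∉⇒All≢ {xs = _ ∷ _} x∉ = (x∉ ∘ here) ∷ ∉⇒All≢ (x∉ ∘ there)

  All≢⇒∉ : ∀ {xs : Vec A k} → All (x ≢_) xs → x ∉ᵥ xs
  All≢⇒∉ (x≢y ∷ _)  (here x≡y) = x≢y x≡y
  All≢⇒∉ (_ ∷ x≢ys) (there x∈) = All≢⇒∉ x≢ys x∈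

  Unique-∷⁺ : ∀ {xs : Vec A k} → x ∉ᵥ xs → Unique xs → Unique (x ∷ xs)
  Unique-∷⁺ x∉ u = ∉⇒All≢ x∉ ∷ u

  All-∷ʳ⁺ : ∀ {P : Pred A 0ℓ} {xs : Vec A k} → All P xs → P x → All P (xs ∷ʳ x)
  All-∷ʳ⁺ []         px = px ∷ []
  All-∷ʳ⁺ (py ∷ pxs) px = py ∷ All-∷ʳ⁺ pxs px

  Unique-∷ʳ⁺ : ∀ {xs : Vec A k} → Unique xs → x ∉ᵥ xs → Unique (xs ∷ʳ x)
  Unique-∷ʳ⁺ []         _  = [] ∷ []
  Unique-∷ʳ⁺ (y≢ys ∷ u) x∉ = All-∷ʳ⁺ y≢ys (λ y≡x → x∉ (here (sym y≡x))) ∷ Unique-∷ʳ⁺ u (x∉ ∘ there)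

  lookup-∷ʳ-inject₁ : (xs : Vec A k) (i : Fin k) → lookup (xs ∷ʳ x) (inject₁ i) ≡ lookup xs i
  lookup-∷ʳ-inject₁ (_ ∷ _)  zero    = refl
  lookup-∷ʳ-inject₁ (_ ∷ xs) (suc i) = lookup-∷ʳ-inject₁ xs i

  lookup-∷ʳ-fromℕ : (xs : Vec A k) → lookup (xs ∷ʳ x) (fromℕ k) ≡ x
  lookup-∷ʳ-fromℕ []       = refl
  lookup-∷ʳ-fromℕ (_ ∷ xs) = lookup-∷ʳ-fromℕ xs

opposite-injective : ∀ {k} → Injective _≡_ _≡_ (opposite {k})
opposite-injective {_} {i} {j} eq =
  trans (sym (opposite-involutive i)) (trans (cong opposite eq) (opposite-involutive j))

opposite-inject₁ : ∀ {k} (i : Fin k) → opposite (inject₁ i) ≡ suc (opposite i)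
opposite-inject₁ zero    = refl
opposite-inject₁ (suc i) = cong inject₁ (opposite-inject₁ i)

head∈ᵥ : ∀ {A : Set} (xs : Vec A (suc k)) → Vec.head xs ∈ᵥ xs
head∈ᵥ (_ ∷ _) = here refl

∉⇒∉ᵥ : ∀ {p : Subset n} {y} {zs : Vec (Fin n) k} → All (_∈ p) zs → y ∉ p → y ∉ᵥ zs
∉⇒∉ᵥ zs⊆p y∉p y∈zs = y∉p (All.lookup zs⊆p y∈zs)

∉-∷ : ∀ {A : Set} {x y : A} {ys : Vec A k} → x ≢ y → x ∉ᵥ ys → x ∉ᵥ y ∷ ys
∉-∷ x≢y _    (here x≡y)  = x≢y x≡y
∉-∷ _   x∉ys (there x∈ys) = x∉ys x∈ys

all-or-counterexample : ∀ {P Q : Pred (Fin n) 0ℓ} → Decidable P → Decidable Q →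
                        (∀ x → P x → Q x) ⊎ ∃ λ x → P x × ¬ Q x
all-or-counterexample P? Q? with any? (λ x → P? x ×-dec ¬? (Q? x))
... | yes counterexample = inj₂ counterexample
... | no  none           = inj₁ λ x px → decidable-stable (Q? x) (λ ¬qx → none (x , px , ¬qx))

Covers : ∀ {q} → Pred (Fin n) 0ℓ → Subset n → Vec (Fin n) q → Set
Covers P seen xs = ∀ x → P x → x ∈ seen ⊎ x ∈ᵥ xs

module _ {P : Pred (Fin n) 0ℓ} {seen : Subset n} where

  Covers-allFin : Covers P seen (allFin n)
  Covers-allFin x _ = inj₂ (∈-allFin⁺ x)

  Covers-[] : Covers P seen [] → ∀ x → P x → x ∈ seen
  Covers-[] cov x px with cov x px
  ... | inj₁ x∈ = x∈

  Covers-skip : ∀ {q y} {ys : Vec (Fin n) q} → Covers P seen (y ∷ ys) → ¬ (P y × y ∉ seen) → Covers P seen ys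
  Covers-skip cov skip x px with cov x px
  ... | inj₁ x∈        = inj₁ x∈
  ... | inj₂ (there x∈) = inj₂ x∈
  ... | inj₂ (here refl) with x ∈? seen
  ...   | yes x∈ = inj₁ x∈
  ...   | no  x∉ = contradiction (px , x∉) skip

  Covers-visit : ∀ {q y seen'} {ys : Vec (Fin n) q} → Covers P seen (y ∷ ys) →
                 seen ⊆ seen' → y ∈ seen' → Covers P seen' ys
  Covers-visit cov seen⊆ y∈ x px with cov x px
  ... | inj₁ x∈         = inj₁ (seen⊆ x∈)
  ... | inj₂ (there x∈)  = inj₂ x∈
  ... | inj₂ (here refl) = inj₁ y∈

-- Composes two bounds "edges gained ≤ vertices gained + excess"; d extra vertices are seen in between.
excess-trans : ∀ {E₀ V₀ E₁ V₁ E₂ V₂} d a b → E₁ + V₀ ≤ V₁ + E₀ + a → E₂ + (d + V₁) ≤ V₂ + E₁ + b →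
               d + (E₂ + V₀) ≤ V₂ + E₀ + (a + b)
excess-trans {E₀} {V₀} {E₁} {V₁} {E₂} {V₂} d a b first second =
  +-cancelʳ-≤ (E₁ + V₁) _ _
    (subst₂ _≤_ (lhs E₀ V₀ E₁ V₁ E₂ V₂ d) (rhs E₀ V₀ E₁ V₁ E₂ V₂ a b) (+-mono-≤ first second))
  where
  lhs : ∀ E₀ V₀ E₁ V₁ E₂ V₂ d → (E₁ + V₀) + (E₂ + (d + V₁)) ≡ (d + (E₂ + V₀)) + (E₁ + V₁)
  lhs = solve-∀
  rhs : ∀ E₀ V₀ E₁ V₁ E₂ V₂ a b → (V₁ + E₀ + a) + (V₂ + E₁ + b) ≡ (V₂ + E₀ + (a + b)) + (E₁ + V₁)
  rhs = solve-∀

-- Hypergraphs and Berge paths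

module _ {n : ℕ} (H : Hypergraph n) where

  closed-under-adjacency⇒everything : Connected H → (p : Subset n) →
    (∀ {x y} → Adjacent H x y → x ∈ p → y ∈ p) → ∀ {x} → x ∈ p → ∀ y → y ∈ p
  closed-under-adjacency⇒everything connected p closed {x} x∈p y with connected x y
  ... | len , w , w₀≡x , wₗ≡y , adjacent =
    subst (_∈ p) wₗ≡y (along len w adjacent (subst (_∈ p) (sym w₀≡x) x∈p))
    where
    along : ∀ len (w : Fin (suc len) → Fin n) → (∀ j → Adjacent H (w (inject₁ j)) (w (suc j))) →
            w zero ∈ p → w (fromℕ len) ∈ p
    along zero      w _        w₀∈p = w₀∈p
    along (suc len) w adjacent w₀∈p = along len (w ∘ suc) (adjacent ∘ suc) (closed (adjacent zero) w₀∈p)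

module UniformEdges {n r : ℕ} (H : Hypergraph n) (uniform : Uniform r H) where

  r≤∣p∣ : ∀ {e p} → edge H e ⊆ p → r ≤ ∣ p ∣
  r≤∣p∣ {e} e⊆p = subst (_≤ _) (uniform e) (p⊆q⇒∣p∣≤∣q∣ e⊆p)

  edge-fills : ∀ {e p} → edge H e ⊆ p → ∣ p ∣ ≤ r → p ⊆ edge H e
  edge-fills {e} e⊆p ∣p∣≤r = p⊆q∧∣q∣≤∣p∣⇒q⊆p e⊆p (subst (_ ≤_) (sym (uniform e)) ∣p∣≤r)

  edge-nonempty : 1 ≤ r → ∀ e → ∃ λ x → x ∈ edge H e
  edge-nonempty 1≤r e with any? (_∈? edge H e)
  ... | yes x∈e = x∈e
  ... | no  ∄x∈e = contradiction (subst (1 ≤_) (∣⊥∣≡0 n) (≤-trans 1≤r (r≤∣p∣ {e} {⊥} e⊆⊥))) λ ()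
    where
    e⊆⊥ : edge H e ⊆ ⊥
    e⊆⊥ x∈e = contradiction (_ , x∈e) ∄x∈e

  edges-equal : ∀ {e f p} → edge H e ⊆ p → edge H f ⊆ p → ∣ p ∣ ≤ r → e ≡ f
  edges-equal e⊆p f⊆p ∣p∣≤r =
    distinct H (⊆-antisym (edge-fills f⊆p ∣p∣≤r ∘ e⊆p) (edge-fills e⊆p ∣p∣≤r ∘ f⊆p))

module Paths {n : ℕ} (H : Hypergraph n) (v : Fin n) where

  Vertex : Set
  Vertex = Fin n

  Edge : Set
  Edge = Fin (m H)

  _∈E_ : Vertex → Edge → Set
  x ∈E e = x ∈ edge H e

  -- A Berge walk ending at v, listed from its far end back to v.
  data Walk : ∀ {j} → Vec Vertex (suc j) → Vec Edge j → Set where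
    start : Walk (v ∷ []) []
    step  : ∀ {j x e} {xs : Vec Vertex (suc j)} {es} →
            x ∈E e → Vec.head xs ∈E e → Walk xs es → Walk (x ∷ xs) (e ∷ es)

  walk-links : ∀ {j} {xs : Vec Vertex (suc j)} {es} → Walk xs es → ∀ i →
               lookup xs (inject₁ i) ∈E lookup es i × lookup xs (suc i) ∈E lookup es i
  walk-links {xs = _ ∷ _ ∷ _} (step x∈e y∈e _) zero    = x∈e , y∈e
  walk-links                  (step _   _   w) (suc i) = walk-links w i

  walk-ends-at-v : ∀ {j} {xs : Vec Vertex (suc j)} {es} → Walk xs es → lookup xs (fromℕ j) ≡ v
  walk-ends-at-v start        = refl
  walk-ends-at-v (step _ _ w) = walk-ends-at-v w

  v∈walk : ∀ {j} {xs : Vec Vertex (suc j)} {es} → Walk xs es → v ∈ᵥ xs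
  v∈walk start        = here refl
  v∈walk (step _ _ w) = there (v∈walk w)

  record Path (j : ℕ) : Set where
    constructor path
    field
      verts        : Vec Vertex (suc j)
      edges        : Vec Edge j
      walk         : Walk verts edges
      verts-unique : Unique verts
      edges-unique : Unique edges

    tip : Vertex
    tip = Vec.head verts

  open Path public

  trivial : Path 0
  trivial = path (v ∷ []) [] start ([] ∷ []) []

  extend : ∀ {j} (P : Path j) {e y} → y ∈E e → tip P ∈E e → y ∉ᵥ verts P → e ∉ᵥ edges P → Path (suc j)
  extend P y∈e tip∈e y∉ e∉ =
    path (_ ∷ verts P) (_ ∷ edges P) (step y∈e tip∈e (walk P))
         (Unique-∷⁺ y∉ (verts-unique P)) (Unique-∷⁺ e∉ (edges-unique P))

  tip≢v : ∀ {j} (P : Path (suc j)) → tip P ≢ v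
  tip≢v (path (x ∷ _) _ (step _ _ w) (x∉ ∷ _) _) refl = All≢⇒∉ x∉ (v∈walk w)

  berge-path : ∀ {j} → Path j → BergePathFrom H j v
  berge-path (path xs es w uxs ues) =
    (λ i → lookup es (opposite i)) , (λ i → lookup xs (opposite i)) ,
    (λ eq → opposite-injective (lookup-injective ues _ _ eq)) ,
    (λ eq → opposite-injective (lookup-injective uxs _ _ eq)) ,
    (λ i → subst (λ t → lookup xs t ∈E lookup es (opposite i)) (sym (opposite-inject₁ i))
                 (proj₂ (walk-links w (opposite i))) ,
           proj₁ (walk-links w (opposite i))) ,
    walk-ends-at-v w

  berge-cycle : ∀ {j} (P : Path j) {e} → e ∉ᵥ edges P → tip P ∈E e → v ∈E e → BergeCycleThrough H j v
  berge-cycle (path (x ∷ xs) es w uxs ues) {e} e∉ x∈e v∈e =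
    lookup (es ∷ʳ e) , lookup (x ∷ xs) ,
    (λ eq → lookup-injective (Unique-∷ʳ⁺ ues e∉) _ _ eq) ,
    (λ eq → lookup-injective uxs _ _ eq) ,
    (λ i → subst (lookup (x ∷ xs) (inject₁ i) ∈E_) (sym (lookup-∷ʳ-inject₁ es i)) (proj₁ (walk-links w i)) ,
           subst (lookup (x ∷ xs) (suc i) ∈E_) (sym (lookup-∷ʳ-inject₁ es i)) (proj₂ (walk-links w i))) ,
    subst₂ _∈E_ (sym (walk-ends-at-v w)) (sym (lookup-∷ʳ-fromℕ es)) v∈e ,
    subst (x ∈E_) (sym (lookup-∷ʳ-fromℕ es)) x∈e ,
    fromℕ _ , walk-ends-at-v w

module Exploration (r : ℕ) (2≤r : 2 ≤ r) {n : ℕ} (H : Hypergraph n) (uniform : Uniform r H) (v : Fin n) where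

  open Paths H v
  open UniformEdges H uniform

  Witness : Set
  Witness = BergePathFrom H (suc r) v ⊎ BergeCycleThrough H r v

  path-witness : ∀ {j} → j ≡ suc r → Path j → Witness
  path-witness refl P = inj₁ (berge-path P)

  cycle-witness : ∀ {j} → j ≡ r → ∀ (P : Path j) {e} → e ∉ᵥ edges P → tip P ∈E e → v ∈E e → Witness
  cycle-witness refl P e∉ tip∈e v∈e = inj₂ (berge-cycle P e∉ tip∈e v∈e)

  ∣stack∣≤r : ∀ {j} → suc j ≡ r → (xs : Vec Vertex (suc j)) → ∣ toSubset xs ∣ ≤ r
  ∣stack∣≤r eq xs = subst (_ ≤_) eq (∣toSubset∣≤length xs)

  ∣stack-v∣≤r : ∀ {j} → j ≡ r → (P : Path j) → ∣ toSubset (verts P) - v ∣ ≤ r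
  ∣stack-v∣≤r refl P =
    ≤-pred (≤-trans (x∈p⇒∣p-x∣<∣p∣ (∈-toSubset⁺ (v∈walk (walk P)))) (∣toSubset∣≤length (verts P)))

  ⊆stack-v : ∀ {j} {P : Path j} {e} → edge H e ⊆ toSubset (verts P) → v ∉ edge H e →
             edge H e ⊆ toSubset (verts P) - v
  ⊆stack-v e⊆ v∉e y∈e = x∈p∧x≢y⇒x∈p-y (e⊆ y∈e) λ { refl → v∉e y∈e }

  leave-or-close : ∀ {j} → j ≡ r → ∀ (P : Path j) {e} → tip P ∈E e → e ∉ᵥ edges P →
                   Witness ⊎ edge H e ⊆ toSubset (verts P) - v
  leave-or-close eq P {e} tip∈e e∉ with all-or-counterexample (_∈? edge H e) (_∈? toSubset (verts P))
  ... | inj₂ (y , y∈e , y∉) = inj₁ (path-witness (cong suc eq) (extend P y∈e tip∈e (y∉ ∘ ∈-toSubset⁺) e∉))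
  ... | inj₁ e⊆ with v ∈? edge H e
  ...   | yes v∈e = inj₁ (cycle-witness eq P e∉ tip∈e v∈e)
  ...   | no  v∉e = inj₂ (⊆stack-v {P = P} (e⊆ _) v∉e)

  -- Replacing the last edge f of P by e gives another path of length r, to which the same dichotomy
  -- applies with f; if f also misses v, then e and f both fill the r vertices of P other than v.
  replace-last-edge : ∀ {j} → suc (suc j) ≡ r → ∀ (P : Path (suc (suc j))) {e} → tip P ∈E e → e ∉ᵥ edges P →
                      edge H e ⊆ toSubset (verts P) - v → Witness
  replace-last-edge {j} eq P@(path (x ∷ x′ ∷ xs) (f ∷ es) (step x∈f x′∈f w) (x∉ ∷ ux) (f∉ ∷ ue)) {e} x∈e e∉ e⊆
    with leave-or-close eq P′ x∈f f∉P′
    where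
    x′∈e : x′ ∈E e
    x′∈e = edge-fills e⊆ (∣stack-v∣≤r eq P)
             (x∈p∧x≢y⇒x∈p-y (∈-toSubset⁺ {xs = x ∷ x′ ∷ xs} (there (here refl))) (tip≢v (path (x′ ∷ xs) es w ux ue)))
    P′ : Path (suc (suc j))
    P′ = path (x ∷ x′ ∷ xs) (e ∷ es) (step x∈e x′∈e w) (x∉ ∷ ux) (Unique-∷⁺ (e∉ ∘ there) ue)
    f∉P′ : f ∉ᵥ e ∷ es
    f∉P′ (here f≡e) = e∉ (here (sym f≡e))
    f∉P′ (there f∈) = All≢⇒∉ f∉ f∈
  ... | inj₁ witness = witness
  ... | inj₂ f⊆      = contradiction (here (edges-equal e⊆ f⊆ (∣stack-v∣≤r eq P))) e∉

  unused-tip-edge⇒witness : ∀ {j} → j ≡ r → ∀ (P : Path j) {e} → tip P ∈E e → e ∉ᵥ edges P → Witness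
  unused-tip-edge⇒witness eq P tip∈e e∉ with leave-or-close eq P tip∈e e∉ | subst (2 ≤_) (sym eq) 2≤r
  ... | inj₁ witness | _           = witness
  ... | inj₂ e⊆      | s≤s (s≤s _) = replace-last-edge eq P tip∈e e∉ e⊆

  -- The depth-first search

  record State : Set where
    constructor ⟨_,_⟩
    field
      seenV : Subset n
      seenE : Subset (m H)

  open State

  visitV : Vertex → State → State
  visitV y s = ⟨ ⁅ y ⁆ ∪ seenV s , seenE s ⟩

  visitE : Edge → State → State
  visitE e s = ⟨ seenV s , ⁅ e ⁆ ∪ seenE s ⟩

  infix 4 _⊑_
  _⊑_ : State → State → Set
  s ⊑ s′ = seenV s ⊆ seenV s′ × seenE s ⊆ seenE s′

  ⊑-refl : ∀ {s} → s ⊑ s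
  ⊑-refl = (λ x∈ → x∈) , (λ e∈ → e∈)

  ⊑-trans : ∀ {s₁ s₂ s₃} → s₁ ⊑ s₂ → s₂ ⊑ s₃ → s₁ ⊑ s₃
  ⊑-trans (V₁⊆V₂ , E₁⊆E₂) (V₂⊆V₃ , E₂⊆E₃) = V₂⊆V₃ ∘ V₁⊆V₂ , E₂⊆E₃ ∘ E₁⊆E₂

  ⊑-visitV : ∀ {y s} → s ⊑ visitV y s
  ⊑-visitV {y} = q⊆p∪q ⁅ y ⁆ _ , (λ e∈ → e∈)

  ⊑-visitE : ∀ {e s} → s ⊑ visitE e s
  ⊑-visitE {e} = (λ x∈ → x∈) , q⊆p∪q ⁅ e ⁆ _

  -- Over s, the state s′ has gained at most l more edges than vertices.
  record Excess≤ (l : ℕ) (s s′ : State) : Set where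
    constructor excess≤
    field
      bound : ∣ seenE s′ ∣ + ∣ seenV s ∣ ≤ ∣ seenV s′ ∣ + ∣ seenE s ∣ + l

  Excess≤-refl : ∀ {s} → Excess≤ 0 s s
  Excess≤-refl {s} = excess≤ (≤-reflexive (trans (+-comm ∣ seenE s ∣ ∣ seenV s ∣) (sym (+-identityʳ _))))

  Excess≤-visitE : ∀ {e s} → e ∉ seenE s → Excess≤ 1 s (visitE e s)
  Excess≤-visitE {e} {s} e∉ = excess≤ (≤-reflexive (begin
    ∣ ⁅ e ⁆ ∪ seenE s ∣ + ∣ seenV s ∣ ≡⟨ cong (_+ ∣ seenV s ∣) (∣⁅x⁆∪p∣≡1+∣p∣ e∉) ⟩
    suc ∣ seenE s ∣ + ∣ seenV s ∣     ≡⟨ cong suc (+-comm ∣ seenE s ∣ ∣ seenV s ∣) ⟩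
    suc (∣ seenV s ∣ + ∣ seenE s ∣)   ≡⟨ +-comm 1 _ ⟩
    ∣ seenV s ∣ + ∣ seenE s ∣ + 1     ∎))
    where open ≡-Reasoning

  Excess≤-trans : ∀ {a b s₁ s₂ s₃} → Excess≤ a s₁ s₂ → Excess≤ b s₂ s₃ → Excess≤ (a + b) s₁ s₃
  Excess≤-trans {a} {b} {s₁} {s₂} {s₃} (excess≤ first) (excess≤ second) = excess≤
    (excess-trans {∣ seenE s₁ ∣} {∣ seenV s₁ ∣} {∣ seenE s₂ ∣} {∣ seenV s₂ ∣} {∣ seenE s₃ ∣} {∣ seenV s₃ ∣}
                  0 a b first second)

  Excess≤-through-vertex : ∀ {a b l s c y c′} → Excess≤ a s c → y ∉ seenV c → Excess≤ b (visitV y c) c′ →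
                           a + b ≤ suc l → Excess≤ l s c′
  Excess≤-through-vertex {a} {b} {l} {s} {c} {y} {c′} (excess≤ before) y∉ (excess≤ after) a+b≤1+l =
    excess≤ (≤-pred (begin
      suc (∣ seenE c′ ∣ + ∣ seenV s ∣)       ≤⟨ excess-trans {∣ seenE s ∣} {∣ seenV s ∣} {∣ seenE c ∣} {∣ seenV c ∣}
                                                            {∣ seenE c′ ∣} {∣ seenV c′ ∣} 1 a b before after′ ⟩
      ∣ seenV c′ ∣ + ∣ seenE s ∣ + (a + b)   ≤⟨ +-monoʳ-≤ (∣ seenV c′ ∣ + ∣ seenE s ∣) a+b≤1+l ⟩
      ∣ seenV c′ ∣ + ∣ seenE s ∣ + suc l     ≡⟨ +-suc (∣ seenV c′ ∣ + ∣ seenE s ∣) l ⟩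
      suc (∣ seenV c′ ∣ + ∣ seenE s ∣ + l)   ∎))
    where
    open ≤-Reasoning
    after′ : ∣ seenE c′ ∣ + suc ∣ seenV c ∣ ≤ ∣ seenV c′ ∣ + ∣ seenE c ∣ + b
    after′ = subst (λ t → ∣ seenE c′ ∣ + t ≤ ∣ seenV c′ ∣ + ∣ seenE c ∣ + b) (∣⁅x⁆∪p∣≡1+∣p∣ y∉) after

  -- The depth-first search invariant: a seen vertex or edge that is no longer on the stack is finished,
  -- i.e. all of its neighbours in the incidence graph have been seen.
  record Invariant {i j} (s : State) (xs : Vec Vertex i) (es : Vec Edge j) : Set where
    field
      stackV-seen : All (_∈ seenV s) xs
      stackE-seen : All (_∈ seenE s) es
      finishedV   : ∀ {x e} → x ∈ seenV s → x ∉ᵥ xs → x ∈E e → e ∈ seenE s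
      finishedE   : ∀ {e x} → e ∈ seenE s → e ∉ᵥ es → x ∈E e → x ∈ seenV s

  open Invariant

  initial : State
  initial = ⟨ ⁅ v ⁆ , ⊥ ⟩

  Invariant-initial : Invariant initial (v ∷ []) []
  Invariant-initial = record
    { stackV-seen = x∈⁅x⁆ v ∷ []
    ; stackE-seen = []
    ; finishedV   = λ x∈ x∉ _ → contradiction (here (x∈⁅y⁆⇒x≡y v x∈)) x∉
    ; finishedE   = λ e∈ _ _ → contradiction e∈ ∉⊥
    }

  module _ {i j} {xs : Vec Vertex i} {es : Vec Edge j} where

    Invariant-pushV : ∀ {y s} → Invariant s xs es → Invariant (visitV y s) (y ∷ xs) es
    Invariant-pushV {y} {s} I = record
      { stackV-seen = x∈⁅x⁆∪p ∷ All.map (proj₁ (⊑-visitV {y} {s})) (stackV-seen I)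
      ; stackE-seen = stackE-seen I
      ; finishedV   = λ x∈ x∉ x∈e → [ (λ x≡y → contradiction (here x≡y) x∉)
                                     , (λ x∈s → finishedV I x∈s (x∉ ∘ there) x∈e) ]′ (x∈⁅y⁆∪p⁻ x∈)
      ; finishedE   = λ e∈ e∉ x∈e → proj₁ (⊑-visitV {y} {s}) (finishedE I e∈ e∉ x∈e)
      }

    Invariant-popV : ∀ {y s} → Invariant s (y ∷ xs) es → (∀ {e} → y ∈E e → e ∈ seenE s) → Invariant s xs es
    Invariant-popV {y} I y-done = record
      { stackV-seen = All.tail (stackV-seen I)
      ; stackE-seen = stackE-seen I
      ; finishedV   = λ {x} x∈ x∉ x∈e → case x ≟ y of λ where
                        (yes refl) → y-done x∈e
                        (no x≢y)   → finishedV I x∈ (λ { (here x≡y) → x≢y x≡y ; (there x∈xs) → x∉ x∈xs }) x∈e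
      ; finishedE   = finishedE I
      }

    Invariant-pushE : ∀ {g s} → Invariant s xs es → Invariant (visitE g s) xs (g ∷ es)
    Invariant-pushE {g} {s} I = record
      { stackV-seen = stackV-seen I
      ; stackE-seen = x∈⁅x⁆∪p ∷ All.map (proj₂ (⊑-visitE {g} {s})) (stackE-seen I)
      ; finishedV   = λ x∈ x∉ x∈e → proj₂ (⊑-visitE {g} {s}) (finishedV I x∈ x∉ x∈e)
      ; finishedE   = λ e∈ e∉ x∈e → [ (λ e≡g → contradiction (here e≡g) e∉)
                                     , (λ e∈s → finishedE I e∈s (e∉ ∘ there) x∈e) ]′ (x∈⁅y⁆∪p⁻ e∈)
      }

    Invariant-popE : ∀ {g s} → Invariant s xs (g ∷ es) → (∀ {y} → y ∈E g → y ∈ seenV s) → Invariant s xs es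
    Invariant-popE {g} I g-done = record
      { stackV-seen = stackV-seen I
      ; stackE-seen = All.tail (stackE-seen I)
      ; finishedV   = finishedV I
      ; finishedE   = λ {e} e∈ e∉ x∈e → case e ≟ g of λ where
                        (yes refl) → g-done x∈e
                        (no e≢g)   → finishedE I e∈ (λ { (here e≡g) → e≢g e≡g ; (there e∈es) → e∉ e∈es }) x∈e
      }

  record Leaf {i} (xs : Vec Vertex i) (s s′ : State) : Set where
    constructor leaf
    field
      leaf-edge     : Edge
      unseen-before : leaf-edge ∉ seenE s
      seen-after    : leaf-edge ∈ seenE s′
      on-stack      : edge H leaf-edge ⊆ toSubset xs

  open Leaf

  data Linked (s s′ : State) (x z : Vertex) : Set where
    linked-by : ∀ h → h ∉ seenE s → h ∈ seenE s′ → x ∈E h → z ∈E h → Linked s s′ x z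

  -- A leaf edge found below a vertex one level above the depth limit is the only way the
  -- exploration below a vertex can gain more edges than vertices.
  VertexBalance : ∀ {i} → ℕ → Vec Vertex i → State → State → Set
  VertexBalance k xs s s′ = Excess≤ 0 s s′ ⊎ (k ≡ 1 × Leaf xs s s′ × Excess≤ 1 s s′)

  EdgeBalance : ∀ {i} → ℕ → Vec Vertex i → Edge → State → State → Set
  EdgeBalance k xs g s s′ = Excess≤ 0 s s′ ⊎ (k ≡ 0 × edge H g ⊆ toSubset xs × Excess≤ 1 s s′)

  -- Below a vertex at depth j, with stack xs and es, the search may still descend k levels: j + k ≡ r.
  module _ {j} (k : ℕ) (xs : Vec Vertex (suc j)) (es : Vec Edge j) where

    record VertexProgress (s s′ : State) : Set where
      field
        grown     : s ⊑ s′
        invariant : Invariant s′ xs es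
        balance   : VertexBalance k xs s s′
        linked    : k ≡ 1 → ∀ {z} → z ∈ seenV s′ → z ∉ seenV s → Linked s s′ (Vec.head xs) z
        no-new    : k ≡ 0 → seenV s′ ⊆ seenV s

    record VertexResult (s : State) : Set where
      field
        final    : State
        progress : VertexProgress s final
        tip-done : ∀ {e} → Vec.head xs ∈E e → e ∈ seenE final

    record EdgeResult (g : Edge) (s : State) : Set where
      field
        final     : State
        grown     : s ⊑ final
        g-seen    : g ∈ seenE final
        invariant : Invariant final xs es
        balance   : EdgeBalance k xs g s final
        new-in-g  : k ≡ 0 → ∀ {z} → z ∈ seenV final → z ∉ seenV s → z ∈E g

    data EdgeStatus (g : Edge) (s c : State) : Set where
      untouched       : c ≡ visitE g s → EdgeStatus g s c
      balanced        : Excess≤ 0 s c → EdgeStatus g s c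
      one-leafy-child : ∀ {x} → x ∈E g → x ∉ seenV s → x ∈ seenV c → k ≡ 1 → Leaf (x ∷ xs) (visitE g s) c →
                        (∀ {z} → z ∈ seenV c → z ∉ seenV s → z ≡ x ⊎ Linked (visitE g s) c x z) →
                        Excess≤ 1 s c → EdgeStatus g s c

    record EdgeProgress (g : Edge) (s c : State) : Set where
      field
        grown     : visitE g s ⊑ c
        invariant : Invariant c xs (g ∷ es)
        status    : EdgeStatus g s c
        new-in-g  : k ≡ 0 → ∀ {z} → z ∈ seenV c → z ∉ seenV s → z ∈E g

  module VP = VertexProgress
  module VR = VertexResult
  module ER = EdgeResult
  module EP = EdgeProgress

  Linked-grow : ∀ {s c c′ x z} → seenE c ⊆ seenE c′ → Linked s c x z → Linked s c′ x z
  Linked-grow c⊆c′ (linked-by h h∉ h∈ x∈h z∈h) = linked-by h h∉ (c⊆c′ h∈) x∈h z∈h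

  Leaf-grow : ∀ {i} {xs : Vec Vertex i} {s c c′} → seenE c ⊆ seenE c′ → Leaf xs s c → Leaf xs s c′
  Leaf-grow c⊆c′ (leaf f f∉ f∈ f⊆) = leaf f f∉ (c⊆c′ f∈) f⊆

  vertex-step : ∀ {j k} {xs : Vec Vertex (suc j)} {es} {s c e} → j + suc k ≡ r →
                VertexProgress (suc k) xs es s c → Vec.head xs ∈E e → e ∉ seenE c →
                (R : EdgeResult k xs es e c) → VertexProgress (suc k) xs es s (ER.final R)
  vertex-step {j} {k} {xs} {es} {s} {c} {e} eq prog tip∈e e∉ R = record
    { grown     = ⊑-trans (VP.grown prog) (ER.grown R)
    ; invariant = ER.invariant R
    ; balance   = combine (VP.balance prog) (ER.balance R)
    ; linked    = linked
    ; no-new    = λ ()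
    }
    where
    e∉s : e ∉ seenE s
    e∉s = e∉ ∘ proj₂ (VP.grown prog)
    combine : VertexBalance (suc k) xs s c → EdgeBalance k xs e c (ER.final R) →
              VertexBalance (suc k) xs s (ER.final R)
    combine (inj₁ b₁) (inj₁ b₂) = inj₁ (Excess≤-trans b₁ b₂)
    combine (inj₁ b₁) (inj₂ (refl , e⊆ , b₂)) =
      inj₂ (refl , leaf e e∉s (ER.g-seen R) e⊆ , Excess≤-trans b₁ b₂)
    combine (inj₂ (k≡ , L , b₁)) (inj₁ b₂) =
      inj₂ (k≡ , Leaf-grow (proj₂ (ER.grown R)) L , Excess≤-trans b₁ b₂)
    combine (inj₂ (_ , L , _)) (inj₂ (k≡0 , e⊆ , _)) = contradiction
      (subst (_∈ seenE c) (edges-equal (on-stack L) e⊆ (∣stack∣≤r (depth-limit k≡0) xs)) (seen-after L)) e∉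
      where
      depth-limit : k ≡ 0 → suc j ≡ r
      depth-limit refl = trans (+-comm 1 j) eq
    linked : suc k ≡ 1 → ∀ {z} → z ∈ seenV (ER.final R) → z ∉ seenV s → Linked s (ER.final R) (Vec.head xs) z
    linked 1+k≡1 {z} z∈ z∉ with z ∈? seenV c
    ... | yes z∈c = Linked-grow (proj₂ (ER.grown R)) (VP.linked prog 1+k≡1 z∈c z∉)
    ... | no  z∉c = linked-by e e∉s (ER.g-seen R) tip∈e (ER.new-in-g R (suc-injective 1+k≡1) z∈ z∉c)

  Leaf-visitV : ∀ {i} {xs : Vec Vertex i} {c c′ y} → Leaf xs (visitV y c) c′ → Leaf xs c c′
  Leaf-visitV (leaf f f∉ f∈ f⊆) = leaf f f∉ f∈ f⊆

  Linked-visitV : ∀ {c c′ y x z} → Linked (visitV y c) c′ x z → Linked c c′ x z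
  Linked-visitV (linked-by h h∉ h∈ x∈h z∈h) = linked-by h h∉ h∈ x∈h z∈h

  leaf-fills-stack : ∀ {j} {xs : Vec Vertex (suc j)} {s s′} → suc j ≡ r → (L : Leaf xs s s′) →
                     ∀ {z} → z ∈ᵥ xs → z ∈E leaf-edge L
  leaf-fills-stack {xs = xs} eq L z∈ = edge-fills (on-stack L) (∣stack∣≤r eq xs) (∈-toSubset⁺ z∈)

  -- The Berge cycle  v ⋯ tip P ─e₁─ x₁ ─e₂─ x₂ ─e₃─ v.
  cycle-through-two-new-vertices : ∀ {j} → suc (suc j) ≡ r → ∀ (P : Path j) {e₁ e₂ e₃ x₁ x₂} →
    tip P ∈E e₁ → x₁ ∈E e₁ → x₁ ∈E e₂ → x₂ ∈E e₂ → x₂ ∈E e₃ → v ∈E e₃ →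
    x₁ ∉ᵥ verts P → x₂ ∉ᵥ x₁ ∷ verts P →
    e₁ ∉ᵥ edges P → e₂ ∉ᵥ e₁ ∷ edges P → e₃ ∉ᵥ e₂ ∷ e₁ ∷ edges P → Witness
  cycle-through-two-new-vertices eq P tip∈e₁ x₁∈e₁ x₁∈e₂ x₂∈e₂ x₂∈e₃ v∈e₃ x₁∉ x₂∉ e₁∉ e₂∉ e₃∉ =
    cycle-witness eq (extend (extend P x₁∈e₁ tip∈e₁ x₁∉ e₁∉) x₂∈e₂ x₁∈e₂ x₂∉ e₂∉) e₃∉ x₂∈e₃ v∈e₃

  one-level-above-limit : ∀ {j k} → suc j + k ≡ r → k ≡ 1 → suc (suc j) ≡ r
  one-level-above-limit {j} eq refl = trans (+-comm 1 (suc j)) eq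

  -- Two children x, y of g carrying leaves f, f′ close the cycle  v ⋯ tip ─f─ x ─g─ y ─f′─ v.
  two-leafy-children⇒witness : ∀ {j k} → suc (suc j) ≡ r → ∀ (P : Path j) {g s c c′ x y} → tip P ∈E g →
    g ∉ seenE s → Invariant s (verts P) (edges P) → EdgeProgress k (verts P) (edges P) g s c →
    x ∈E g → x ∉ seenV s → x ∈ seenV c → Leaf (x ∷ verts P) (visitE g s) c →
    y ∈E g → y ∉ seenV c → Leaf (y ∷ verts P) (visitV y c) c′ → Witness
  two-leafy-children⇒witness eq P {g} {s} tip∈g g∉s I prog x∈g x∉s x∈c L@(leaf f f∉ f∈c _)
                             y∈g y∉c L′@(leaf f′ f′∉ _ _) =
    cycle-through-two-new-vertices eq P
      (leaf-fills-stack eq L (there (head∈ᵥ (verts P)))) (leaf-fills-stack eq L (here refl)) x∈g y∈g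
      (leaf-fills-stack eq L′ (here refl)) (leaf-fills-stack eq L′ (there (v∈walk (walk P))))
      (∉⇒∉ᵥ (stackV-seen I) x∉s)
      (∉⇒∉ᵥ (x∈c ∷ stackV-seen (EP.invariant prog)) y∉c)
      (∉⇒∉ᵥ (stackE-seen I) (f∉ ∘ proj₂ (⊑-visitE {g} {s})))
      (∉-∷ (λ { refl → f∉ x∈⁅x⁆∪p }) (∉⇒∉ᵥ (stackE-seen I) g∉s))
      (∉⇒∉ᵥ (All.head (stackE-seen (EP.invariant prog)) ∷ f∈c ∷ All.tail (stackE-seen (EP.invariant prog))) f′∉)

  edge-step : ∀ {j k} → suc j + k ≡ r → ∀ (P : Path j) {g s c y} → tip P ∈E g → g ∉ seenE s →
    Invariant s (verts P) (edges P) → EdgeProgress k (verts P) (edges P) g s c → y ∈E g → y ∉ seenV c →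
    (R : VertexResult k (y ∷ verts P) (g ∷ edges P) (visitV y c)) →
    Witness ⊎ EdgeProgress k (verts P) (edges P) g s (VR.final R)
  edge-step {j} {k} eq P {g} {s} {c} {y} tip∈g g∉s I prog y∈g y∉c R =
    Sum.map₂ (λ status → record
      { grown     = ⊑-trans (EP.grown prog) (⊑-trans (⊑-visitV {y} {c}) (VP.grown progress))
      ; invariant = Invariant-popV (VP.invariant progress) (VR.tip-done R)
      ; status    = status
      ; new-in-g  = new-in-g
      })
      (next-status (EP.status prog) (VP.balance progress))
    where
    progress = VR.progress R
    c′ = VR.final R
    y∉s : y ∉ seenV s
    y∉s = y∉c ∘ proj₁ (EP.grown prog)
    new-in-g : k ≡ 0 → ∀ {z} → z ∈ seenV c′ → z ∉ seenV s → z ∈E g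
    new-in-g k≡0 {z} z∈ z∉ with z ∈? seenV c
    ... | yes z∈c = EP.new-in-g prog k≡0 z∈c z∉
    ... | no  z∉c with x∈⁅y⁆∪p⁻ (VP.no-new progress k≡0 z∈)
    ...   | inj₁ refl = y∈g
    ...   | inj₂ z∈c  = contradiction z∈c z∉c
    next-status : EdgeStatus k (verts P) (edges P) g s c → VertexBalance k (y ∷ verts P) (visitV y c) c′ →
                  Witness ⊎ EdgeStatus k (verts P) (edges P) g s c′
    next-status (untouched refl) (inj₁ b) =
      inj₂ (balanced (Excess≤-through-vertex (Excess≤-visitE g∉s) y∉c b ≤-refl))
    next-status (untouched refl) (inj₂ (k≡1 , L , b)) =
      inj₂ (one-leafy-child y∈g y∉s (proj₁ (VP.grown progress) x∈⁅x⁆∪p) k≡1 (Leaf-visitV L) new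
                            (Excess≤-through-vertex (Excess≤-visitE g∉s) y∉c b ≤-refl))
      where
      new : ∀ {z} → z ∈ seenV c′ → z ∉ seenV s → z ≡ y ⊎ Linked (visitE g s) c′ y z
      new {z} z∈ z∉ with z ≟ y
      ... | yes z≡y = inj₁ z≡y
      ... | no  z≢y = inj₂ (Linked-visitV (VP.linked progress k≡1 z∈ (λ z∈′ → [ z≢y , z∉ ]′ (x∈⁅y⁆∪p⁻ z∈′))))
    next-status (balanced b₀) (inj₁ b) =
      inj₂ (balanced (Excess≤-through-vertex b₀ y∉c b z≤n))
    next-status (balanced b₀) (inj₂ (_ , _ , b)) =
      inj₂ (balanced (Excess≤-through-vertex b₀ y∉c b ≤-refl))
    next-status (one-leafy-child _ _ _ _ _ _ b₀) (inj₁ b) =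
      inj₂ (balanced (Excess≤-through-vertex b₀ y∉c b ≤-refl))
    next-status (one-leafy-child x∈g x∉s x∈c k≡1 L _ _) (inj₂ (_ , L′ , _)) =
      inj₁ (two-leafy-children⇒witness (one-level-above-limit eq k≡1) P tip∈g g∉s I prog x∈g x∉s x∈c L y∈g y∉c L′)

  -- If g has a vertex w off the stack, then w was first reached from the only child x of g,
  -- through an edge h; this closes the cycle  v ⋯ tip ─g─ w ─h─ x ─f─ v.
  leafy-only-child⇒witness : ∀ {j} → suc (suc j) ≡ r → ∀ (P : Path j) {g s c x} → tip P ∈E g → g ∉ seenE s →
    Invariant s (verts P) (edges P) → (∀ {y} → y ∈E g → y ∈ seenV c) →
    x ∉ seenV s → Leaf (x ∷ verts P) (visitE g s) c →
    (∀ {z} → z ∈ seenV c → z ∉ seenV s → z ≡ x ⊎ Linked (visitE g s) c x z) → Witness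
  leafy-only-child⇒witness eq P {g} {s} {c} {x} tip∈g g∉s I g-done x∉s L@(leaf f f∉ _ f⊆) new
    with all-or-counterexample (_∈? edge H g) (_∈? toSubset (x ∷ verts P))
  ... | inj₁ g⊆ =
    contradiction (subst (_∈ seenE (visitE g s)) (edges-equal (g⊆ _) f⊆ (∣stack∣≤r eq (x ∷ verts P))) x∈⁅x⁆∪p) f∉
  ... | inj₂ (w , w∈g , w∉) = close (new (g-done w∈g) w∉s)
    where
    w∉P : w ∉ᵥ verts P
    w∉P = w∉ ∘ ∈-toSubset⁺ ∘ there
    w∉s : w ∉ seenV s
    w∉s w∈s = g∉s (finishedV I w∈s w∉P w∈g)
    close : w ≡ x ⊎ Linked (visitE g s) c x w → Witness
    close (inj₁ w≡x) = contradiction (∈-toSubset⁺ {xs = x ∷ verts P} (here w≡x)) w∉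
    close (inj₂ (linked-by h h∉ _ x∈h w∈h)) =
      cycle-through-two-new-vertices eq P tip∈g w∈g w∈h x∈h
        (leaf-fills-stack eq L (here refl)) (leaf-fills-stack eq L (there (v∈walk (walk P))))
        w∉P (∉-∷ (λ x≡w → w∉ (∈-toSubset⁺ {xs = x ∷ verts P} (here (sym x≡w)))) (∉⇒∉ᵥ (stackV-seen I) x∉s))
        (∉⇒∉ᵥ (stackE-seen I) g∉s) (∉⇒∉ᵥ (stackE-seen (Invariant-pushE I)) h∉)
        (∉-∷ (λ f≡h → w∉ (f⊆ (subst (w ∈E_) (sym f≡h) w∈h))) (∉⇒∉ᵥ (stackE-seen (Invariant-pushE I)) f∉))

  finish-edge : ∀ {j k} → suc j + k ≡ r → ∀ (P : Path j) {g s c y₀} → tip P ∈E g → g ∉ seenE s →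
    Invariant s (verts P) (edges P) → y₀ ∈E g → y₀ ∉ seenV s → EdgeProgress k (verts P) (edges P) g s c →
    (∀ {y} → y ∈E g → y ∈ seenV c) → Witness ⊎ EdgeResult k (verts P) (edges P) g s
  finish-edge eq P {g} {s} {c} tip∈g g∉s I y₀∈g y₀∉s prog g-done with EP.status prog
  ... | untouched refl = contradiction (g-done y₀∈g) y₀∉s
  ... | balanced b = inj₂ record
    { final     = c
    ; grown     = ⊑-trans (⊑-visitE {g} {s}) (EP.grown prog)
    ; g-seen    = proj₂ (EP.grown prog) x∈⁅x⁆∪p
    ; invariant = Invariant-popE (EP.invariant prog) g-done
    ; balance   = inj₁ b
    ; new-in-g  = EP.new-in-g prog
    }
  ... | one-leafy-child _ x∉s _ k≡1 L new _ =
    inj₁ (leafy-only-child⇒witness (one-level-above-limit eq k≡1) P tip∈g g∉s I g-done x∉s L new)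

  -- An unseen edge all of whose vertices are seen lies on the stack, so the stack has r vertices.
  edge-without-new-vertex : ∀ {j k} → suc j + k ≡ r → ∀ {xs : Vec Vertex (suc j)} {es g s} → g ∉ seenE s →
    Invariant s xs es → (∀ {y} → y ∈E g → y ∈ seenV s) → EdgeResult k xs es g s
  edge-without-new-vertex {j} {k} eq {xs} {es} {g} {s} g∉s I g-seen-vertices = record
    { final     = visitE g s
    ; grown     = ⊑-visitE {g} {s}
    ; g-seen    = x∈⁅x⁆∪p
    ; invariant = Invariant-popE (Invariant-pushE I) g-seen-vertices
    ; balance   = inj₂ (k≡0 , g⊆xs , Excess≤-visitE g∉s)
    ; new-in-g  = λ _ z∈ z∉ → contradiction z∈ z∉
    }
    where
    g⊆xs : edge H g ⊆ toSubset xs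
    g⊆xs {y} y∈g with y ∈? toSubset xs
    ... | yes y∈ = y∈
    ... | no  y∉ = contradiction (finishedV I (g-seen-vertices y∈g) (y∉ ∘ ∈-toSubset⁺) y∈g) g∉s
    k≡0 : k ≡ 0
    k≡0 = n≤0⇒n≡0 (+-cancelˡ-≤ (suc j) k 0 (begin
      suc j + k         ≡⟨ eq ⟩
      r                 ≤⟨ r≤∣p∣ g⊆xs ⟩
      ∣ toSubset xs ∣   ≤⟨ ∣toSubset∣≤length xs ⟩
      suc j             ≡⟨ +-identityʳ (suc j) ⟨
      suc j + 0         ∎))
      where open ≤-Reasoning

  start-vertex : ∀ {j k} {xs : Vec Vertex (suc j)} {es s} → Invariant s xs es → VertexProgress k xs es s s
  start-vertex I = record
    { grown     = ⊑-refl
    ; invariant = I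
    ; balance   = inj₁ Excess≤-refl
    ; linked    = λ _ z∈ z∉ → contradiction z∈ z∉
    ; no-new    = λ _ z∈ → z∈
    }

  start-edge : ∀ {j k} {xs : Vec Vertex (suc j)} {es g s} → Invariant s xs es →
               EdgeProgress k xs es g s (visitE g s)
  start-edge I = record
    { grown     = ⊑-refl
    ; invariant = Invariant-pushE I
    ; status    = untouched refl
    ; new-in-g  = λ _ z∈ z∉ → contradiction z∈ z∉
    }

  mutual

    explore-vertex : ∀ {j} (k : ℕ) → j + k ≡ r → ∀ (P : Path j) s → Invariant s (verts P) (edges P) →
                     Witness ⊎ VertexResult k (verts P) (edges P) s
    explore-vertex zero eq P s I with all-or-counterexample (λ e → tip P ∈? edge H e) (_∈? seenE s)
    ... | inj₂ (e , tip∈e , e∉s) =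
      inj₁ (unused-tip-edge⇒witness (trans (sym (+-identityʳ _)) eq) P tip∈e (∉⇒∉ᵥ (stackE-seen I) e∉s))
    ... | inj₁ tip-done = inj₂ record { final = s ; progress = start-vertex I ; tip-done = tip-done _ }
    explore-vertex (suc k) eq P s I = scan-edges k eq P s (allFin _) (start-vertex I) Covers-allFin

    scan-edges : ∀ {j q} (k : ℕ) → j + suc k ≡ r → ∀ (P : Path j) s (candidates : Vec Edge q) {c} →
                 VertexProgress (suc k) (verts P) (edges P) s c → Covers (tip P ∈E_) (seenE c) candidates →
                 Witness ⊎ VertexResult (suc k) (verts P) (edges P) s
    scan-edges k eq P s [] {c} prog covered =
      inj₂ record { final = c ; progress = prog ; tip-done = λ {e} → Covers-[] covered e }
    scan-edges k eq P s (e ∷ es) {c} prog covered with tip P ∈? edge H e ×-dec ¬? (e ∈? seenE c)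
    ... | no skip = scan-edges k eq P s es prog (Covers-skip covered skip)
    ... | yes (tip∈e , e∉c) with explore-edge k (trans (sym (+-suc _ k)) eq) P e tip∈e c e∉c (VP.invariant prog)
    ...   | inj₁ witness = inj₁ witness
    ...   | inj₂ R =
      scan-edges k eq P s es (vertex-step eq prog tip∈e e∉c R)
                 (Covers-visit covered (proj₂ (ER.grown R)) (ER.g-seen R))

    explore-edge : ∀ {j} (k : ℕ) → suc j + k ≡ r → ∀ (P : Path j) g → tip P ∈E g → ∀ s → g ∉ seenE s →
                   Invariant s (verts P) (edges P) → Witness ⊎ EdgeResult k (verts P) (edges P) g s
    explore-edge k eq P g tip∈g s g∉s I with all-or-counterexample (_∈? edge H g) (_∈? seenV s)
    ... | inj₁ g-seen = inj₂ (edge-without-new-vertex eq g∉s I (g-seen _))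
    ... | inj₂ (_ , y₀∈g , y₀∉s) =
      scan-vertices k eq P g tip∈g s g∉s I y₀∈g y₀∉s (allFin _) (start-edge I) Covers-allFin

    scan-vertices : ∀ {j q} (k : ℕ) → suc j + k ≡ r → ∀ (P : Path j) g → tip P ∈E g → ∀ s → g ∉ seenE s →
                    Invariant s (verts P) (edges P) → ∀ {y₀} → y₀ ∈E g → y₀ ∉ seenV s →
                    ∀ (candidates : Vec Vertex q) {c} → EdgeProgress k (verts P) (edges P) g s c →
                    Covers (_∈E g) (seenV c) candidates → Witness ⊎ EdgeResult k (verts P) (edges P) g s
    scan-vertices k eq P g tip∈g s g∉s I y₀∈g y₀∉s [] prog covered =
      finish-edge eq P tip∈g g∉s I y₀∈g y₀∉s prog (λ {y} → Covers-[] covered y)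
    scan-vertices k eq P g tip∈g s g∉s I y₀∈g y₀∉s (y ∷ ys) {c} prog covered
      with y ∈? edge H g ×-dec ¬? (y ∈? seenV c)
    ... | no skip = scan-vertices k eq P g tip∈g s g∉s I y₀∈g y₀∉s ys prog (Covers-skip covered skip)
    ... | yes (y∈g , y∉c)
      with explore-vertex k eq
             (extend P y∈g tip∈g (∉⇒∉ᵥ (stackV-seen (EP.invariant prog)) y∉c) (∉⇒∉ᵥ (stackE-seen I) g∉s))
             (visitV y c) (Invariant-pushV (EP.invariant prog))
    ...   | inj₁ witness = inj₁ witness
    ...   | inj₂ R with edge-step eq P tip∈g g∉s I prog y∈g y∉c R
    ...     | inj₁ witness = inj₁ witness
    ...     | inj₂ prog′ =
      scan-vertices k eq P g tip∈g s g∉s I y₀∈g y₀∉s ys prog′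
        (Covers-visit covered (proj₁ (VP.grown (VR.progress R)) ∘ proj₁ (⊑-visitV {y} {c}))
                              (proj₁ (VP.grown (VR.progress R)) x∈⁅x⁆∪p))

  -- A search from v that finds no witness sees everything, yet beyond v it never sees more edges
  -- than vertices.
  exhausted-search⇒few-edges : Connected H → VertexResult r (v ∷ []) [] initial → suc (m H) ≤ n
  exhausted-search⇒few-edges connected R with VP.balance (VR.progress R)
  ... | inj₂ (r≡1 , _) = contradiction (subst (2 ≤_) r≡1 2≤r) λ { (s≤s ()) }
  ... | inj₁ (excess≤ bound) = begin
    suc (m H)                               ≡⟨ +-comm 1 (m H) ⟩
    m H + 1                                 ≡⟨ cong₂ _+_ (sym (∣⊤∣≡n (m H))) (sym (∣⁅x⁆∣≡1 v)) ⟩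
    ∣ ⊤ {m H} ∣ + ∣ ⁅ v ⁆ ∣                 ≤⟨ +-monoˡ-≤ ∣ ⁅ v ⁆ ∣ (p⊆q⇒∣p∣≤∣q∣ {p = ⊤} (λ {e} _ → all-edges-seen e)) ⟩
    ∣ seenE final ∣ + ∣ ⁅ v ⁆ ∣             ≤⟨ bound ⟩
    ∣ seenV final ∣ + ∣ ⊥ {m H} ∣ + 0       ≡⟨ cong (λ t → ∣ seenV final ∣ + t + 0) (∣⊥∣≡0 (m H)) ⟩
    ∣ seenV final ∣ + 0 + 0                 ≤⟨ ≤-reflexive (trans (+-identityʳ _) (+-identityʳ _)) ⟩
    ∣ seenV final ∣                         ≤⟨ ∣p∣≤n (seenV final) ⟩
    n                                       ∎
    where
    open ≤-Reasoning
    open VertexResult R using (final)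
    I = VP.invariant (VR.progress R)
    edges-at-seen-vertex : ∀ {x e} → x ∈ seenV final → x ∈E e → e ∈ seenE final
    edges-at-seen-vertex {x} x∈ x∈e with x ≟ v
    ... | yes refl = VR.tip-done R x∈e
    ... | no  x≢v  = finishedV I x∈ (∉-∷ x≢v λ ()) x∈e
    all-vertices-seen : ∀ y → y ∈ seenV final
    all-vertices-seen =
      closed-under-adjacency⇒everything H connected (seenV final)
        (λ (e , x∈e , y∈e) x∈ → finishedE I (edges-at-seen-vertex x∈ x∈e) (λ ()) y∈e)
        (proj₁ (VP.grown (VR.progress R)) (x∈⁅x⁆ v))
    all-edges-seen : ∀ e → e ∈ seenE final
    all-edges-seen e = let x , x∈e = edge-nonempty (≤-trans (s≤s z≤n) 2≤r) e in
                       edges-at-seen-vertex (all-vertices-seen x) x∈e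

  witness-exists : Connected H → n ≤ m H → Witness
  witness-exists connected n≤m =
    fromInj₁ (λ R → contradiction n≤m (<⇒≱ (exhausted-search⇒few-edges connected R)))
             (explore-vertex r refl trivial initial Invariant-initial)

theorem3 : (r : ℕ) → 2 ≤ r → (n : ℕ) → (H : Hypergraph n) →
    Connected H → Uniform r H → n ≤ e H →
    (v : Fin n) → BergePathFrom H (suc r) v ⊎ BergeCycleThrough H r v
theorem3 r 2≤r n H connected uniform n≤e v = witness-exists connected n≤e
  where open Exploration r 2≤r H uniform v
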